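{- For every integer $k\ge 4$, there is a $2K_2$-free graph $G$ with $\chi(G)=k$ that admits a frozen $(k+1)$-colouring.
   Context: A $k$-colouring of a graph $G$ is a partition of $V(G)$ into at most $k$ (ordered, possibly empty) independent sets called colour classes. A $k$-colouring is frozen if every vertex $v$ has a neighbour in each of the $k$ colour classes other than the one containing $v$ (equivalently, the colouring is an isolated vertex of the reconfiguration graph of $k$-colourings, in which two colourings are adjacent when they differ on exactly one vertex). $2K_2$ is the disjoint union of two edges; $G$ is $2K_2$-free if it has no induced subgraph isomorphic to $2K_2$. -}

module Defs where

open import Data.Nat using (ℕ; _<_)
open import Data.Fin using (Fin)
open import Data.Bool using (Bool; true; false)
open import Data.Product using (Σ; ∃; _×_; _,_)
open import Relation.Binary.PropositionalEquality using (_≡_; _≢_)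
open import Relation.Nullary using (¬_)
open import Data.Empty using (⊥)

record Graph : Set where
  field
    n     : ℕ
    adj   : Fin n → Fin n → Bool
    sym   : ∀ u v → adj u v ≡ adj v u
    irrefl : ∀ v → adj v v ≡ false

open Graph public

Adj : (G : Graph) → Fin (n G) → Fin (n G) → Set
Adj G u v = adj G u v ≡ true

Colouring : Graph → ℕ → Set
Colouring G k = Fin (n G) → Fin k

IsProper : (G : Graph) {k : ℕ} → Colouring G k → Set
IsProper G c = ∀ u v → Adj G u v → c u ≢ c v

Colourable : Graph → ℕ → Set
Colourable G k = Σ (Colouring G k) (IsProper G)

ChromaticNumber≡ : Graph → ℕ → Set
ChromaticNumber≡ G k = Colourable G k × (∀ m → m < k → ¬ Colourable G m)

IsFrozen : (G : Graph) {k : ℕ} → Colouring G k → Set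
IsFrozen G {k} c =
  IsProper G c ×
  (∀ (v : Fin (n G)) (i : Fin k) → i ≢ c v → ∃ λ u → Adj G v u × c u ≡ i)

-- 2K2-free: no induced 2K2, i.e. no four vertices a,b,x,y with a~b, x~y and
-- no edges between {a,b} and {x,y}. (Such vertices are automatically distinct
-- by irreflexivity/non-adjacency.)
TwoK2Free : Graph → Set
TwoK2Free G = ∀ a b x y → Adj G a b → Adj G x y →
  adj G a x ≡ false → adj G a y ≡ false →
  adj G b x ≡ false → adj G b y ≡ false → ⊥

{-# OPTIONS --safe #-}
module Submission where

-- Adding a universal vertex keeps a graph 2K₂-free, raises its chromatic number
-- by one, and extends a frozen colouring by one new colour for the new vertex,
-- which sees every old colour class because a frozen colouring of a nonempty
-- graph uses all its colours. So only k = 4 needs an example. Take the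
-- complement of the graph H formed by two triangles joined by an edge and by
-- two paths of length three. Every cycle of H other than the triangles has
-- length at least six, so H has no C₄ and its complement has no 2K₂. The
-- perfect matching of H made of the joining edge and the end edges of the two
-- paths lies in no triangle of H, so its edges are the classes of a frozen
-- 5-colouring of the complement; on the other hand H is covered by four cliques
-- and has an independent set of size four.

open import Defs
open import Data.Nat using (ℕ; zero; suc; _+_; _∸_; _≤_; _<_; s≤s)
open import Data.Nat.Properties using (m∸n+n≡m)
open import Data.Bool using (Bool; true; false; not; _∨_)
import Data.Bool.Properties as Bool
open import Data.Fin using (Fin; zero; suc; #_; punchOut)
open import Data.Fin.Properties
  using (_≟_; all?; any?; suc-injective; punchOut-injective; pigeonhole; <⇒≢)
open import Data.List using (List; _∷_; [])
open import Data.Product using (Σ; ∃; _×_; _,_)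
open import Data.Product.Properties using (≡-dec)
open import Data.Vec using (_∷_; []; lookup)
open import Function using (_∘_)
open import Relation.Nullary using (¬_; Dec; does; yes; no; ¬?; contradiction)
open import Relation.Nullary.Decidable using (_→-dec_; _×-dec_; from-yes)
open import Relation.Binary.PropositionalEquality using (_≡_; _≢_; refl; cong; subst)
import Relation.Binary.PropositionalEquality as ≡
open import Data.List.Membership.DecPropositional (≡-dec (_≟_ {10}) (_≟_ {10}))
  using (_∈?_)

Adj? : (G : Graph) → ∀ u v → Dec (Adj G u v)
Adj? G u v = adj G u v Bool.≟ true

IsProper? : (G : Graph) {k : ℕ} (c : Colouring G k) → Dec (IsProper G c)
IsProper? G c = all? λ u → all? λ v → Adj? G u v →-dec ¬? (c u ≟ c v)

IsFrozen? : (G : Graph) {k : ℕ} (c : Colouring G k) → Dec (IsFrozen G c)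
IsFrozen? G c = IsProper? G c ×-dec all? λ v → all? λ i →
  ¬? (i ≟ c v) →-dec any? λ u → Adj? G v u ×-dec c u ≟ i

TwoK2Free? : (G : Graph) → Dec (TwoK2Free G)
TwoK2Free? G = all? λ a → all? λ b → all? λ x → all? λ y →
  Adj? G a b →-dec Adj? G x y →-dec
  adj G a x Bool.≟ false →-dec adj G a y Bool.≟ false →-dec
  adj G b x Bool.≟ false →-dec adj G b y Bool.≟ false →-dec no λ ()

coneAdj : ∀ {m} → (Fin m → Fin m → Bool) → Fin (suc m) → Fin (suc m) → Bool
coneAdj a zero    zero    = false
coneAdj a zero    (suc _) = true
coneAdj a (suc _) zero    = true
coneAdj a (suc u) (suc v) = a u v

cone : Graph → Graph
cone G = record
  { n      = suc (n G)
  ; adj    = coneAdj (adj G)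
  ; sym    = cone-sym
  ; irrefl = cone-irrefl
  }
  where
  cone-sym : ∀ u v → coneAdj (adj G) u v ≡ coneAdj (adj G) v u
  cone-sym zero    zero    = refl
  cone-sym zero    (suc v) = refl
  cone-sym (suc u) zero    = refl
  cone-sym (suc u) (suc v) = sym G u v

  cone-irrefl : ∀ v → coneAdj (adj G) v v ≡ false
  cone-irrefl zero    = refl
  cone-irrefl (suc v) = irrefl G v

FrozenAboveχ : ℕ → Graph → Set
FrozenAboveχ k G =
  TwoK2Free G × ChromaticNumber≡ G k × Σ (Colouring G (suc k)) (IsFrozen G)

module _ {G : Graph} where

  clique⇒¬Colourable : ∀ {k m} (q : Fin k → Fin (n G)) →
    (∀ i j → i ≢ j → Adj G (q i) (q j)) → m < k → ¬ Colourable G m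
  clique⇒¬Colourable q clique m<k (c , proper) =
    let i , j , i<j , cqi≡cqj = pigeonhole m<k (c ∘ q)
    in proper (q i) (q j) (clique i j (<⇒≢ i<j)) cqi≡cqj

  IsFrozen⇒surjective : ∀ {k} {c : Colouring G k} → IsFrozen G c →
    Fin (n G) → ∀ i → ∃ λ u → c u ≡ i
  IsFrozen⇒surjective {c = c} (_ , nbrs) v i with i ≟ c v
  ... | yes i≡cv = v , ≡.sym i≡cv
  ... | no  i≢cv = let u , _ , cu≡i = nbrs v i i≢cv in u , cu≡i

  cone-TwoK2Free : TwoK2Free G → TwoK2Free (cone G)
  cone-TwoK2Free 2K2-free (suc a) (suc b) (suc x) (suc y) = 2K2-free a b x y
  cone-TwoK2Free _ zero    _       (suc _) _       _  _ () _  _  _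
  cone-TwoK2Free _ zero    _       zero    (suc _) _  _ _  () _  _
  cone-TwoK2Free _ zero    _       zero    zero    _  ()
  cone-TwoK2Free _ (suc _) zero    (suc _) _       _  _ _  _  () _
  cone-TwoK2Free _ (suc _) zero    zero    (suc _) _  _ _  _  _  ()
  cone-TwoK2Free _ (suc _) zero    zero    zero    _  ()
  cone-TwoK2Free _ (suc _) (suc _) zero    _       _  _ () _  _  _
  cone-TwoK2Free _ (suc _) (suc _) (suc _) zero    _  _ _  () _  _

  cone-colouring : ∀ {k} → Colouring G k → Colouring (cone G) (suc k)
  cone-colouring c zero    = zero
  cone-colouring c (suc v) = suc (c v)

  cone-IsProper : ∀ {k} {c : Colouring G k} →
    IsProper G c → IsProper (cone G) (cone-colouring c)
  cone-IsProper proper zero    zero    ()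
  cone-IsProper proper zero    (suc v) _  ()
  cone-IsProper proper (suc u) zero    _  ()
  cone-IsProper proper (suc u) (suc v) uv = proper u v uv ∘ suc-injective

  cone-Colourable⁺ : ∀ {k} → Colourable G k → Colourable (cone G) (suc k)
  cone-Colourable⁺ (c , proper) = cone-colouring c , cone-IsProper proper

  cone-Colourable⁻ : ∀ {k} → Colourable (cone G) (suc k) → Colourable G k
  cone-Colourable⁻ (c , proper) = c′ , λ u v uv →
    proper (suc u) (suc v) uv ∘ punchOut-injective (apex≢ u) (apex≢ v)
    where
    apex≢ : ∀ v → c zero ≢ c (suc v)
    apex≢ v = proper zero (suc v) refl

    c′ : Colouring G _
    c′ v = punchOut (apex≢ v)

  cone-ChromaticNumber≡ : ∀ {k} →
    ChromaticNumber≡ G k → ChromaticNumber≡ (cone G) (suc k)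
  cone-ChromaticNumber≡ {k} (colourable , notColourable) =
    cone-Colourable⁺ colourable , notColourable′
    where
    notColourable′ : ∀ m → m < suc k → ¬ Colourable (cone G) m
    notColourable′ zero    _         (c , _) with c zero
    ... | ()
    notColourable′ (suc m) (s≤s m<k) = notColourable m m<k ∘ cone-Colourable⁻

  cone-IsFrozen : ∀ {k} {c : Colouring G k} →
    Fin (n G) → IsFrozen G c → IsFrozen (cone G) (cone-colouring c)
  cone-IsFrozen {c = c} v₀ frozen@(proper , nbrs) = cone-IsProper proper , cone-nbrs
    where
    cone-nbrs : ∀ v i → i ≢ cone-colouring c v →
      ∃ λ u → Adj (cone G) v u × cone-colouring c u ≡ i
    cone-nbrs zero    zero    0≢0  = contradiction refl 0≢0
    cone-nbrs zero    (suc i) _    =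
      let u , cu≡i = IsFrozen⇒surjective frozen v₀ i in suc u , refl , cong suc cu≡i
    cone-nbrs (suc v) zero    _    = zero , refl , refl
    cone-nbrs (suc v) (suc i) i≢cv =
      let u , vu , cu≡i = nbrs v i (i≢cv ∘ cong suc) in suc u , vu , cong suc cu≡i

  cone-FrozenAboveχ : ∀ {k} →
    Fin (n G) → FrozenAboveχ k G → FrozenAboveχ (suc k) (cone G)
  cone-FrozenAboveχ v₀ (2K2-free , χ≡k , c , frozen) =
    cone-TwoK2Free 2K2-free , cone-ChromaticNumber≡ χ≡k ,
    cone-colouring c , cone-IsFrozen v₀ frozen

cone^ : ℕ → Graph → Graph
cone^ zero    G = G
cone^ (suc r) G = cone (cone^ r G)

cone^-vertex : ∀ {G} → Fin (n G) → ∀ r → Fin (n (cone^ r G))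
cone^-vertex v zero    = v
cone^-vertex v (suc r) = zero

cone^-FrozenAboveχ : ∀ {k G} → Fin (n G) →
  ∀ r → FrozenAboveχ k G → FrozenAboveχ (r + k) (cone^ r G)
cone^-FrozenAboveχ v zero    p = p
cone^-FrozenAboveχ v (suc r) p =
  cone-FrozenAboveχ {G = cone^ r _} (cone^-vertex v r) (cone^-FrozenAboveχ v r p)

baseᶜ-edges : List (Fin 10 × Fin 10)
baseᶜ-edges =
  (# 0 , # 1) ∷ (# 0 , # 2) ∷ (# 1 , # 2) ∷
  (# 3 , # 4) ∷ (# 3 , # 5) ∷ (# 4 , # 5) ∷
  (# 0 , # 3) ∷
  (# 1 , # 6) ∷ (# 6 , # 7) ∷ (# 7 , # 4) ∷
  (# 2 , # 8) ∷ (# 8 , # 9) ∷ (# 9 , # 5) ∷ []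

baseAdj : Fin 10 → Fin 10 → Bool
baseAdj u v =
  not (does (u ≟ v) ∨ does ((u , v) ∈? baseᶜ-edges) ∨ does ((v , u) ∈? baseᶜ-edges))

base : Graph
base = record
  { n      = 10
  ; adj    = baseAdj
  ; sym    = from-yes (all? λ u → all? λ v → baseAdj u v Bool.≟ baseAdj v u)
  ; irrefl = from-yes (all? λ v → baseAdj v v Bool.≟ false)
  }

base-4-colouring : Colouring base 4
base-4-colouring =
  lookup (# 0 ∷ # 0 ∷ # 0 ∷ # 1 ∷ # 1 ∷ # 1 ∷ # 2 ∷ # 2 ∷ # 3 ∷ # 3 ∷ [])

base-clique : Fin 4 → Fin 10
base-clique = lookup (# 0 ∷ # 4 ∷ # 6 ∷ # 8 ∷ [])

base-clique-Adj : ∀ i j → i ≢ j → Adj base (base-clique i) (base-clique j)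
base-clique-Adj = from-yes (all? λ i → all? λ j →
  ¬? (i ≟ j) →-dec Adj? base (base-clique i) (base-clique j))

base-ChromaticNumber≡4 : ChromaticNumber≡ base 4
base-ChromaticNumber≡4 =
  (base-4-colouring , from-yes (IsProper? base base-4-colouring)) ,
  λ _ → clique⇒¬Colourable {G = base} base-clique base-clique-Adj

base-5-colouring : Colouring base 5
base-5-colouring =
  lookup (# 0 ∷ # 1 ∷ # 2 ∷ # 0 ∷ # 3 ∷ # 4 ∷ # 1 ∷ # 3 ∷ # 2 ∷ # 4 ∷ [])

base-FrozenAboveχ : FrozenAboveχ 4 base
base-FrozenAboveχ =
  from-yes (TwoK2Free? base) , base-ChromaticNumber≡4 ,
  base-5-colouring , from-yes (IsFrozen? base base-5-colouring)

corollary9 : (k : ℕ) → 4 ≤ k →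
    Σ Graph λ G → TwoK2Free G × ChromaticNumber≡ G k ×
      Σ (Colouring G (suc k)) (IsFrozen G)
corollary9 k 4≤k = subst (λ k → Σ Graph (FrozenAboveχ k)) (m∸n+n≡m 4≤k)
  (cone^ (k ∸ 4) base , cone^-FrozenAboveχ {G = base} zero (k ∸ 4) base-FrozenAboveχ)
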